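{- Let $A\in\mathbb{R}^{n\times m}$, $B\in\mathbb{R}^{m\times n}$, $n\ge2$. A cycle $C$ of $G^{[2]}_{A,B}$ is direct if it has an even number of inversions, and twisted otherwise.
   Context: DSR graph $G_{A,B}$: S-vertices $S_1,\dots,S_n$, R-vertices $R_1,\dots,R_m$; arc $R_j\to S_i$ iff $A_{ij}\ne0$ (sign $\mathrm{sign}(A_{ij})$), arc $S_i\to R_j$ iff $B_{ji}\ne0$ (sign $\mathrm{sign}(B_{ji})$); antiparallel arcs of equal sign form one undirected edge, antiparallel arcs of opposite sign remain two directed edges. A cycle is a nonempty closed walk (edges traversed consistently with orientation) repeating no vertex except first $=$ last. DSR$^{[2]}$ graph: for $s\in\mathbb{R}^n$, $\overline{\mathbf{L}}^s$ is the $\binom n2\times n$ matrix with rows indexed by pairs $(i,j)$, $i<j$, entries $\overline{\mathbf{L}}^s_{(i,j),k}=s_j$ if $k=i$, $-s_i$ if $k=j$, $0$ otherwise; $\overline{\mathbf{L}}^A=[\overline{\mathbf{L}}^{A_1}|\cdots|\overline{\mathbf{L}}^{A_m}]$ for the columns $A_k$ of $A$; $\underline{\mathbf{L}}^B=(\overline{\mathbf{L}}^{B^t})^t$; and $G^{[2]}_{A,B}=G_{\overline{\mathbf{L}}^A,\underline{\mathbf{L}}^B}$, with S-vertices the unordered pairs $ij$ of distinct indices and R-vertices $k^l$ ($1\le k\le m$, $1\le l\le n$). Every edge joins some $ij$ to some $k^l$ with $l\in\{i,j\}$. Direct/twisted. Let $C$ be a cycle of $G^{[2]}_{A,B}$,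 and list its S-vertices in order, starting at some S-vertex, as $\sigma_1,\sigma_2,\dots,\sigma_{r},\sigma_{r+1}=\sigma_1$, where between $\sigma_t$ and $\sigma_{t+1}$ the cycle passes through an R-vertex $k_t^{l_t}$, so $l_t\in\sigma_t\cap\sigma_{t+1}$. Write $\sigma_1=\{a,b\}$. Place a marker $'$ on $a$ and a marker $''$ on $b$. For $t=1,\dots,r$: the markers sit on the two distinct elements of $\sigma_t$; the marker on $l_t$ stays on $l_t$, and the marker on the element of $\sigma_t\setminus\{l_t\}$ moves to the element of $\sigma_{t+1}\setminus\{l_t\}$ (if $\sigma_t=\sigma_{t+1}$ it stays). At the end the markers sit on the two elements of $\sigma_1$. $C$ is direct if marker $'$ ends on $a$, and twisted if it ends on $b$ (this does not depend on the starting S-vertex). Inversions. If $ij$ and $ij'$ are consecutive S-vertices of $C$ with common index $i$ (if they share both indices there is no inversion), the pair is an inversion if $(i-j)(i-j')<0$. The number of inversions of $C$ counts such consecutive pairs around the cycle.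
   Formalization: The matrices A and B have rational entries rather than real ones. -}

module Defs where

open import Data.Bool using (Bool; true; false; if_then_else_)
open import Data.Nat as ℕ using (ℕ; zero; suc)
open import Data.Fin as Fin using (Fin; toℕ)
open import Data.Integer as ℤ using (ℤ)
open import Data.Rational as ℚ using (ℚ; 0ℚ; -_)
open import Data.Product using (_×_; _,_; proj₁; proj₂)
open import Data.List using (List; []; _∷_; _++_; [_]; zip; map; foldl)
open import Data.Nat.ListAction using (sum)
open import Data.List.Relation.Unary.All using (All)
open import Data.List.Relation.Unary.Unique.Propositional using (Unique)
open import Data.Empty using (⊥)
open import Relation.Nullary using (¬_; Dec; yes; no)
open import Relation.Nullary.Decidable using (⌊_⌋)
open import Relation.Binary.PropositionalEquality using (_≡_; _≢_)

-- Real matrices are replaced by rational matrices.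
-- A matrix with rows indexed by I and columns indexed by J.

Matrix : Set → Set → Set
Matrix I J = I → J → ℚ

-- Arc R_j → S_i iff A_ij ≠ 0, arc S_i → R_j iff B_ji ≠ 0.
-- (Signs are irrelevant for which walks are possible: an undirected edge
-- can be traversed both ways, two antiparallel directed edges as well.)

module DSR {I J : Set} (A : Matrix I J) (B : Matrix J I) where

  data Vertex : Set where
    S : I → Vertex
    R : J → Vertex

  Arc : Vertex → Vertex → Set
  Arc (R j) (S i) = A i j ≢ 0ℚ
  Arc (S i) (R j) = B j i ≢ 0ℚ
  Arc (S _) (S _) = ⊥
  Arc (R _) (R _) = ⊥

  cyclicPairs : {X : Set} → List X → List (X × X)
  cyclicPairs []       = []
  cyclicPairs (x ∷ xs) = zip (x ∷ xs) (xs ++ [ x ])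

  -- A cycle, listed starting at an S-vertex:
  -- S σ₁ → R ρ₁ → S σ₂ → R ρ₂ → … → S σᵣ → R ρᵣ → S σ₁,
  -- given as the nonempty list of steps (σ_t , ρ_t), with no repeated vertex.
  record Cycle : Set where
    field
      first  : I × J
      rest   : List (I × J)
    steps : List (I × J)
    steps = first ∷ rest
    field
      arcs     : All (λ pr → Arc (S (proj₁ (proj₁ pr))) (R (proj₂ (proj₁ pr)))
                           × Arc (R (proj₂ (proj₁ pr))) (S (proj₁ (proj₂ pr))))
                     (cyclicPairs steps)
      uniqueS  : Unique (map proj₁ steps)
      uniqueR  : Unique (map proj₂ steps)

-- Unordered pairs ij of distinct indices of Fin n, stored as lo < hi.

record Pair (n : ℕ) : Set where
  constructor pair
  field
    lo hi : Fin n
    lo<hi : lo Fin.< hi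
open Pair public

_∈ᵖ_ : {n : ℕ} → Fin n → Pair n → Bool
k ∈ᵖ p = ⌊ k Fin.≟ lo p ⌋ Data.Bool.∨ ⌊ k Fin.≟ hi p ⌋
  where import Data.Bool

-- the element of p other than l (meaningful when l ∈ p)
other : {n : ℕ} → Pair n → Fin n → Fin n
other p l = if ⌊ l Fin.≟ lo p ⌋ then hi p else lo p

-- Rows of L̄^s are indexed by pairs (i,j),
-- i<j; the columns of L̄^A = [L̄^{A_1}|…|L̄^{A_m}] are indexed by (k , l),
-- meaning column l of block k (this is the R-vertex k^l).

Lbar : {n : ℕ} → (Fin n → ℚ) → Matrix (Pair n) (Fin n)
Lbar s p k =
  if ⌊ k Fin.≟ lo p ⌋ then s (hi p)
  else if ⌊ k Fin.≟ hi p ⌋ then - s (lo p)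
  else 0ℚ

LbarA : {n m : ℕ} → Matrix (Fin n) (Fin m) → Matrix (Pair n) (Fin m × Fin n)
LbarA A p (k , l) = Lbar (λ i → A i k) p l

-- L̲^B = (L̄^{Bᵗ})ᵗ ; the columns of Bᵗ are the rows of B.
LunderB : {n m : ℕ} → Matrix (Fin m) (Fin n) → Matrix (Fin m × Fin n) (Pair n)
LunderB B (k , l) p = Lbar (λ i → B k i) p l

module G2 {n m : ℕ} (A : Matrix (Fin n) (Fin m)) (B : Matrix (Fin m) (Fin n)) =
  DSR (LbarA A) (LunderB B)

module _ {n m : ℕ} {A : Matrix (Fin n) (Fin m)} {B : Matrix (Fin m) (Fin n)} where
  open G2 A B

  -- one step of the markers: state (position of ′ , position of ″),
  -- passing from σ_t via R-vertex k_t^{l_t} to σ_{t+1}.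
  moveMarkers : Fin n × Fin n → (Pair n × (Fin m × Fin n)) × (Pair n × (Fin m × Fin n))
              → Fin n × Fin n
  moveMarkers (p′ , p″) ((σ , (k , l)) , (σ′ , _)) =
    if ⌊ p′ Fin.≟ l ⌋ then (p′ , other σ′ l) else (other σ′ l , p″)

  firstS : Cycle → Pair n
  firstS C = proj₁ (Cycle.first C)

  finalMarkers : Cycle → Fin n × Fin n
  finalMarkers C =
    foldl moveMarkers (lo (firstS C) , hi (firstS C)) (cyclicPairs (Cycle.steps C))

  -- σ₁ = {a , b} with a = lo σ₁, b = hi σ₁; marker ′ starts on a.
  Direct : Cycle → Set
  Direct C = proj₁ (finalMarkers C) ≡ lo (firstS C)

  Twisted : Cycle → Set
  Twisted C = proj₁ (finalMarkers C) ≡ hi (firstS C)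

ι : {n : ℕ} → Fin n → ℤ
ι k = ℤ.+ toℕ k

negProd : {n : ℕ} → Fin n → Fin n → Fin n → Bool
negProd i j j′ = ⌊ ((ι i ℤ.- ι j) ℤ.* (ι i ℤ.- ι j′)) ℤ.<? ℤ.0ℤ ⌋

-- If σ = σ′ (both indices
-- shared) it is not; otherwise let i be the common index, σ = ij, σ′ = ij'.
-- Pairs sharing no index are never consecutive in a cycle; they count 0.
isInversion : {n : ℕ} → Pair n → Pair n → Bool
isInversion σ σ′ =
  if ⌊ lo σ Fin.≟ lo σ′ ⌋ Data.Bool.∧ ⌊ hi σ Fin.≟ hi σ′ ⌋ then false
  else if ⌊ lo σ Fin.≟ lo σ′ ⌋ then negProd (lo σ) (hi σ) (hi σ′)
  else if ⌊ lo σ Fin.≟ hi σ′ ⌋ then negProd (lo σ) (hi σ) (lo σ′)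
  else if ⌊ hi σ Fin.≟ lo σ′ ⌋ then negProd (hi σ) (lo σ) (hi σ′)
  else if ⌊ hi σ Fin.≟ hi σ′ ⌋ then negProd (hi σ) (lo σ) (lo σ′)
  else false
  where import Data.Bool

bool→ℕ : Bool → ℕ
bool→ℕ true  = 1
bool→ℕ false = 0

module _ {n m : ℕ} {A : Matrix (Fin n) (Fin m)} {B : Matrix (Fin m) (Fin n)} where
  open G2 A B

  inversions : Cycle → ℕ
  inversions C =
    sum (map (λ pr → bool→ℕ (isInversion (proj₁ pr) (proj₂ pr)))
             (cyclicPairs (map proj₁ (Cycle.steps C))))

{-# OPTIONS --safe #-}
module Submission where

open import Defs
open import Data.Nat using (ℕ; _≤_)
open import Data.Nat.Divisibility using (_∣_)
open import Data.Fin using (Fin)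
open import Data.Product using (_×_)
open import Relation.Nullary using (¬_)
open import Function.Bundles using (_⇔_)

open import Data.Bool using (Bool; true; false; _xor_; not)
open import Data.Bool.Properties using (xor-assoc; xor-same; xor-identityʳ)
open import Data.Empty using (⊥-elim)
open import Data.Fin using (_≟_)
open import Data.Fin.Properties using (<⇒≢; <-trans)
open import Data.Integer using (ℤ; 0ℤ; +<+; _<?_)
open import Data.List using (List; []; _∷_; _++_; [_]; zip; zipWith; map; foldl; foldr)
open import Data.List.Properties using (map-++; map-∘; zipWith-map; map-zipWith)
open import Data.List.Relation.Unary.All using (All; []; _∷_)
open import Data.Nat using (_+_)
open import Data.Nat.DivMod using (_%_; %-distribˡ-+)
open import Data.Nat.Divisibility using (m%n≡0⇒n∣m; n∣m⇒m%n≡0)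
open import Data.Nat.ListAction using (sum)
open import Data.Product using (_,_; proj₁; proj₂)
import Data.Product as Product
open import Data.Rational using (ℚ; 0ℚ)
open import Function.Bundles using (mk⇔)
import Function.Properties.Equivalence as ⇔
open import Relation.Nullary using (Dec; yes; no)
open import Relation.Nullary.Decidable using (isYes; isYes≗does; dec-true; dec-false)
open import Relation.Binary.PropositionalEquality
  using (_≡_; _≢_; ≢-sym; refl; sym; trans; cong; subst; module ≡-Reasoning)

-- Record the markers on σ = {lo < hi} by one bit: marker ′ sits on lo or on hi.
-- At a step σ → k^l → σ′ the marker on the shared index l stays put, so the bit
-- flips exactly when l passes from being the smaller element of its pair to
-- being the larger one or back, which is what (l − j)(l − j′) < 0 expresses.
-- After one round the bit is therefore the parity of the number of inversions.

isYes-true : ∀ {p} {P : Set p} (P? : Dec P) → P → isYes P? ≡ true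
isYes-true P? p = trans (isYes≗does P?) (dec-true P? p)

isYes-false : ∀ {p} {P : Set p} (P? : Dec P) → ¬ P → isYes P? ≡ false
isYes-false P? ¬p = trans (isYes≗does P?) (dec-false P? ¬p)

xor-cancelʳ : ∀ b x y → (b xor (x xor y)) xor y ≡ b xor x
xor-cancelʳ b x y = begin
  (b xor (x xor y)) xor y ≡⟨ xor-assoc b (x xor y) y ⟩
  b xor ((x xor y) xor y) ≡⟨ cong (b xor_) (xor-assoc x y y) ⟩
  b xor (x xor (y xor y)) ≡⟨ cong (λ z → b xor (x xor z)) (xor-same y) ⟩
  b xor (x xor false)     ≡⟨ cong (b xor_) (xor-identityʳ x) ⟩
  b xor x                 ∎
  where open ≡-Reasoning

parity : List Bool → Bool
parity = foldr _xor_ false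

sum-bool→ℕ-%2 : (bs : List Bool) → sum (map bool→ℕ bs) % 2 ≡ bool→ℕ (parity bs)
sum-bool→ℕ-%2 []           = refl
sum-bool→ℕ-%2 (false ∷ bs) = sum-bool→ℕ-%2 bs
sum-bool→ℕ-%2 (true ∷ bs)  = begin
  (1 + sum (map bool→ℕ bs)) % 2           ≡⟨ %-distribˡ-+ 1 (sum (map bool→ℕ bs)) 2 ⟩
  (1 + sum (map bool→ℕ bs) % 2) % 2       ≡⟨ cong (λ r → (1 + r) % 2) (sum-bool→ℕ-%2 bs) ⟩
  (1 + bool→ℕ (parity bs)) % 2            ≡⟨ suc-bool→ℕ-%2 (parity bs) ⟩
  bool→ℕ (not (parity bs))                ∎
  where
  open ≡-Reasoning
  suc-bool→ℕ-%2 : ∀ b → (1 + bool→ℕ b) % 2 ≡ bool→ℕ (not b)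
  suc-bool→ℕ-%2 false = refl
  suc-bool→ℕ-%2 true  = refl

%2≡bool→ℕ⇒divisibility : (k : ℕ) (t : Bool) → k % 2 ≡ bool→ℕ t
                        → (2 ∣ k ⇔ t ≡ false) × ((¬ 2 ∣ k) ⇔ t ≡ true)
%2≡bool→ℕ⇒divisibility k false k%2≡0 =
  mk⇔ (λ _ → refl) (λ _ → 2∣k) , mk⇔ (λ ¬2∣k → ⊥-elim (¬2∣k 2∣k)) (λ ())
  where
  2∣k : 2 ∣ k
  2∣k = m%n≡0⇒n∣m k 2 k%2≡0
%2≡bool→ℕ⇒divisibility k true k%2≡1 =
  mk⇔ (λ 2∣k → ⊥-elim (¬2∣k 2∣k)) (λ ()) , mk⇔ (λ _ → refl) (λ _ → ¬2∣k)
  where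
  ¬2∣k : ¬ 2 ∣ k
  ¬2∣k 2∣k with trans (sym k%2≡1) (n∣m⇒m%n≡0 k 2 2∣k)
  ... | ()

module _ {i j : ℤ} where
  open import Data.Integer using (_<_; _-_; _*_; -_; positive; negative)
  open import Data.Integer.Properties
    using (+-inverseʳ; +-monoˡ-<; *-monoʳ-<-pos; *-monoʳ-<-neg; *-comm; <-asym)

  i<j⇒i-j<0 : i < j → i - j < 0ℤ
  i<j⇒i-j<0 i<j = subst (i - j <_) (+-inverseʳ j) (+-monoˡ-< (- j) i<j)

  j<i⇒0<i-j : j < i → 0ℤ < i - j
  j<i⇒0<i-j j<i = subst (_< i - j) (+-inverseʳ j) (+-monoˡ-< (- j) j<i)

  neg*pos<0 : i < 0ℤ → 0ℤ < j → i * j < 0ℤ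
  neg*pos<0 i<0 0<j = *-monoʳ-<-pos j {{positive 0<j}} i<0

  pos*neg<0 : 0ℤ < i → j < 0ℤ → i * j < 0ℤ
  pos*neg<0 0<i j<0 = subst (_< 0ℤ) (*-comm j i) (*-monoʳ-<-pos i {{positive 0<i}} j<0)

  pos*pos≮0 : 0ℤ < i → 0ℤ < j → ¬ (i * j < 0ℤ)
  pos*pos≮0 0<i 0<j = <-asym (*-monoʳ-<-pos j {{positive 0<j}} 0<i)

  neg*neg≮0 : i < 0ℤ → j < 0ℤ → ¬ (i * j < 0ℤ)
  neg*neg≮0 i<0 j<0 = <-asym (*-monoʳ-<-neg j {{negative j<0}} i<0)

module _ {n : ℕ} {i j k : Fin n} where
  open import Data.Fin using (_<_)

  negProd-both-above : i < j → i < k → negProd i j k ≡ false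
  negProd-both-above i<j i<k =
    isYes-false (_ <? _) (neg*neg≮0 (i<j⇒i-j<0 (+<+ i<j)) (i<j⇒i-j<0 (+<+ i<k)))

  negProd-both-below : j < i → k < i → negProd i j k ≡ false
  negProd-both-below j<i k<i =
    isYes-false (_ <? _) (pos*pos≮0 (j<i⇒0<i-j (+<+ j<i)) (j<i⇒0<i-j (+<+ k<i)))

  negProd-above-below : i < j → k < i → negProd i j k ≡ true
  negProd-above-below i<j k<i =
    isYes-true (_ <? _) (neg*pos<0 (i<j⇒i-j<0 (+<+ i<j)) (j<i⇒0<i-j (+<+ k<i)))

  negProd-below-above : j < i → i < k → negProd i j k ≡ true
  negProd-below-above j<i i<k =
    isYes-true (_ <? _) (pos*neg<0 (j<i⇒0<i-j (+<+ j<i)) (i<j⇒i-j<0 (+<+ i<k)))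

module _ {n : ℕ} where

  data Endpoint (σ : Pair n) : Fin n → Set where
    lo-endpoint : Endpoint σ (lo σ)
    hi-endpoint : Endpoint σ (hi σ)

  Lbar≢0⇒Endpoint : (s : Fin n → ℚ) (σ : Pair n) (l : Fin n) → Lbar s σ l ≢ 0ℚ → Endpoint σ l
  Lbar≢0⇒Endpoint s σ l Lbar≢0 with l ≟ lo σ
  ... | yes refl = lo-endpoint
  ... | no _ with l ≟ hi σ
  ... | yes refl = hi-endpoint
  ... | no _ = ⊥-elim (Lbar≢0 refl)

  isLo : Pair n → Fin n → Bool
  isLo σ l = isYes (l ≟ lo σ)

  other-endpoint≢ : {σ : Pair n} {l : Fin n} → Endpoint σ l → other σ l ≢ l
  other-endpoint≢ {pair a b a<b} lo-endpoint
    rewrite isYes-true (a ≟ a) refl = ≢-sym (<⇒≢ a<b)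
  other-endpoint≢ {pair a b a<b} hi-endpoint
    rewrite isYes-false (b ≟ a) (≢-sym (<⇒≢ a<b)) = <⇒≢ a<b

  isInversion-shared : {σ σ′ : Pair n} {l : Fin n} → Endpoint σ l → Endpoint σ′ l
                     → isInversion σ σ′ ≡ isLo σ l xor isLo σ′ l
  isInversion-shared {pair a b a<b} {pair .a d a<d} lo-endpoint lo-endpoint
    rewrite isYes-true (a ≟ a) refl with b ≟ d
  ... | yes _ = refl
  ... | no _  = negProd-both-above a<b a<d
  isInversion-shared {pair a b a<b} {pair c .a c<a} lo-endpoint hi-endpoint
    rewrite isYes-true (a ≟ a) refl | isYes-false (a ≟ c) (≢-sym (<⇒≢ c<a))
    = negProd-above-below a<b c<a
  isInversion-shared {pair a b a<b} {pair .b d b<d} hi-endpoint lo-endpoint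
    rewrite isYes-true (b ≟ b) refl | isYes-false (a ≟ b) (<⇒≢ a<b)
          | isYes-false (b ≟ a) (≢-sym (<⇒≢ a<b))
          | isYes-false (a ≟ d) (<⇒≢ (<-trans a<b b<d))
    = negProd-below-above a<b b<d
  isInversion-shared {pair a b a<b} {pair c .b c<b} hi-endpoint hi-endpoint
    rewrite isYes-true (b ≟ b) refl | isYes-false (b ≟ a) (≢-sym (<⇒≢ a<b))
    with a ≟ c
  ... | yes refl rewrite isYes-false (b ≟ a) (≢-sym (<⇒≢ a<b)) = refl
  ... | no _
    rewrite isYes-false (a ≟ b) (<⇒≢ a<b) | isYes-false (b ≟ c) (≢-sym (<⇒≢ c<b))
    = negProd-both-below a<b c<b

  orient : Pair n → Bool → Fin n × Fin n
  orient σ false = lo σ , hi σ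
  orient σ true  = hi σ , lo σ

  markersOn : Bool → Fin n → Fin n → Fin n × Fin n
  markersOn true  l o = l , o
  markersOn false l o = o , l

  orient-markersOn : {σ : Pair n} {l : Fin n} (b : Bool) → Endpoint σ l
                   → orient σ b ≡ markersOn (b xor isLo σ l) l (other σ l)
  orient-markersOn {pair a b a<b} false lo-endpoint rewrite isYes-true (a ≟ a) refl = refl
  orient-markersOn {pair a b a<b} true  lo-endpoint rewrite isYes-true (a ≟ a) refl = refl
  orient-markersOn {pair a b a<b} false hi-endpoint
    rewrite isYes-false (b ≟ a) (≢-sym (<⇒≢ a<b)) = refl
  orient-markersOn {pair a b a<b} true  hi-endpoint
    rewrite isYes-false (b ≟ a) (≢-sym (<⇒≢ a<b)) = refl

  proj₁-orient≡lo⇔ : (σ : Pair n) (t : Bool) → (proj₁ (orient σ t) ≡ lo σ) ⇔ t ≡ false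
  proj₁-orient≡lo⇔ σ false = mk⇔ (λ _ → refl) (λ _ → refl)
  proj₁-orient≡lo⇔ σ true  = mk⇔ (λ hi≡lo → ⊥-elim (<⇒≢ (lo<hi σ) (sym hi≡lo))) (λ ())

  proj₁-orient≡hi⇔ : (σ : Pair n) (t : Bool) → (proj₁ (orient σ t) ≡ hi σ) ⇔ t ≡ true
  proj₁-orient≡hi⇔ σ false = mk⇔ (λ lo≡hi → ⊥-elim (<⇒≢ (lo<hi σ) lo≡hi)) (λ ())
  proj₁-orient≡hi⇔ σ true  = mk⇔ (λ _ → refl) (λ _ → refl)

module _ {n m : ℕ} (A : Matrix (Fin n) (Fin m)) (B : Matrix (Fin m) (Fin n)) where
  open G2 A B

  Step : Set
  Step = Pair n × (Fin m × Fin n)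

  move : Fin n × Fin n → Step × Step → Fin n × Fin n
  move = moveMarkers {A = A} {B = B}

  move-markersOn : (c : Bool) {l o : Fin n} (σ σ′ : Pair n) (k : Fin m) (x : Fin m × Fin n)
                 → o ≢ l
                 → move (markersOn c l o) ((σ , (k , l)) , (σ′ , x)) ≡ markersOn c l (other σ′ l)
  move-markersOn true  {l} σ σ′ k x _ rewrite isYes-true (l ≟ l) refl = refl
  move-markersOn false {l} {o} σ σ′ k x o≢l rewrite isYes-false (o ≟ l) o≢l = refl

  move-orient : (b : Bool) {σ σ′ : Pair n} {l : Fin n} (k : Fin m) (x : Fin m × Fin n)
              → Endpoint σ l → Endpoint σ′ l
              → move (orient σ b) ((σ , (k , l)) , (σ′ , x)) ≡ orient σ′ (b xor isInversion σ σ′)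
  move-orient b {σ} {σ′} {l} k x l∈σ l∈σ′ = begin
    move (orient σ b) e
      ≡⟨ cong (λ ms → move ms e) (orient-markersOn b l∈σ) ⟩
    move (markersOn (b xor isLo σ l) l (other σ l)) e
      ≡⟨ move-markersOn (b xor isLo σ l) σ σ′ k x (other-endpoint≢ l∈σ) ⟩
    markersOn (b xor isLo σ l) l (other σ′ l)
      ≡⟨ cong (λ c → markersOn c l (other σ′ l)) flag ⟩
    markersOn ((b xor isInversion σ σ′) xor isLo σ′ l) l (other σ′ l)
      ≡⟨ orient-markersOn (b xor isInversion σ σ′) l∈σ′ ⟨
    orient σ′ (b xor isInversion σ σ′) ∎
    where
    open ≡-Reasoning
    e : Step × Step
    e = (σ , (k , l)) , (σ′ , x)
    flag : b xor isLo σ l ≡ (b xor isInversion σ σ′) xor isLo σ′ l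
    flag = begin
      b xor isLo σ l
        ≡⟨ xor-cancelʳ b (isLo σ l) (isLo σ′ l) ⟨
      (b xor (isLo σ l xor isLo σ′ l)) xor isLo σ′ l
        ≡⟨ cong (λ t → (b xor t) xor isLo σ′ l) (isInversion-shared l∈σ l∈σ′) ⟨
      (b xor isInversion σ σ′) xor isLo σ′ l ∎

  StepArcs : Step × Step → Set
  StepArcs pr = Arc (S (proj₁ (proj₁ pr))) (R (proj₂ (proj₁ pr)))
              × Arc (R (proj₂ (proj₁ pr))) (S (proj₁ (proj₂ pr)))

  inversion : Step × Step → Bool
  inversion pr = isInversion (proj₁ (proj₁ pr)) (proj₁ (proj₂ pr))

  move-step : (b : Bool) (s e : Step) → StepArcs (s , e)
            → move (orient (proj₁ s) b) (s , e) ≡ orient (proj₁ e) (b xor inversion (s , e))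
  move-step b (σ , (k , l)) (σ′ , x) (σ→kˡ , kˡ→σ′) =
    move-orient b k x (Lbar≢0⇒Endpoint (λ i → B k i) σ l σ→kˡ)
                      (Lbar≢0⇒Endpoint (λ i → A i k) σ′ l kˡ→σ′)

  foldl-move-orient : (b : Bool) (s : Step) (ss : List Step) (e : Step)
                    → All StepArcs (zip (s ∷ ss) (ss ++ [ e ]))
                    → foldl move (orient (proj₁ s) b) (zip (s ∷ ss) (ss ++ [ e ]))
                      ≡ orient (proj₁ e) (b xor parity (map inversion (zip (s ∷ ss) (ss ++ [ e ]))))
  foldl-move-orient b s [] e (arcs ∷ []) = begin
    move (orient (proj₁ s) b) (s , e)
      ≡⟨ move-step b s e arcs ⟩
    orient (proj₁ e) (b xor inversion (s , e))
      ≡⟨ cong (λ t → orient (proj₁ e) (b xor t)) (xor-identityʳ _) ⟨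
    orient (proj₁ e) (b xor (inversion (s , e) xor false)) ∎
    where open ≡-Reasoning
  foldl-move-orient b s (s′ ∷ ss) e (arcs ∷ arcss) = begin
    foldl move (move (orient (proj₁ s) b) (s , s′)) rest
      ≡⟨ cong (λ ms → foldl move ms rest) (move-step b s s′ arcs) ⟩
    foldl move (orient (proj₁ s′) (b xor inversion (s , s′))) rest
      ≡⟨ foldl-move-orient (b xor inversion (s , s′)) s′ ss e arcss ⟩
    orient (proj₁ e) ((b xor inversion (s , s′)) xor parity (map inversion rest))
      ≡⟨ cong (orient (proj₁ e)) (xor-assoc b (inversion (s , s′)) (parity (map inversion rest))) ⟩
    orient (proj₁ e) (b xor (inversion (s , s′) xor parity (map inversion rest))) ∎
    where
    open ≡-Reasoning
    rest : List (Step × Step)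
    rest = zip (s′ ∷ ss) (ss ++ [ e ])

  cyclicPairs-map : {X Y : Set} (f : X → Y) (xs : List X)
                  → cyclicPairs (map f xs) ≡ map (Product.map f f) (cyclicPairs xs)
  cyclicPairs-map f []       = refl
  cyclicPairs-map f (x ∷ xs) = begin
    zip (f x ∷ map f xs) (map f xs ++ [ f x ])
      ≡⟨ cong (zip (map f (x ∷ xs))) (map-++ f xs [ x ]) ⟨
    zip (map f (x ∷ xs)) (map f (xs ++ [ x ]))
      ≡⟨ zipWith-map _,_ f f (x ∷ xs) (xs ++ [ x ]) ⟩
    zipWith (λ a b → f a , f b) (x ∷ xs) (xs ++ [ x ])
      ≡⟨ map-zipWith _,_ (Product.map f f) (x ∷ xs) (xs ++ [ x ]) ⟨
    map (Product.map f f) (zip (x ∷ xs) (xs ++ [ x ])) ∎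
    where open ≡-Reasoning

  twist : Cycle → Bool
  twist C = parity (map inversion (cyclicPairs (Cycle.steps C)))

  finalMarkers≡orient-twist : (C : Cycle)
    → finalMarkers {A = A} {B = B} C ≡ orient (firstS {A = A} {B = B} C) (twist C)
  finalMarkers≡orient-twist C =
    foldl-move-orient false (Cycle.first C) (Cycle.rest C) (Cycle.first C) (Cycle.arcs C)

  inversions-%2 : (C : Cycle) → inversions {A = A} {B = B} C % 2 ≡ bool→ℕ (twist C)
  inversions-%2 C = begin
    sum (map count (cyclicPairs (map proj₁ (Cycle.steps C)))) % 2
      ≡⟨ cong (λ ps → sum (map count ps) % 2) (cyclicPairs-map proj₁ (Cycle.steps C)) ⟩
    sum (map count (map (Product.map proj₁ proj₁) ps)) % 2
      ≡⟨ cong (λ bs → sum bs % 2) (trans (sym (map-∘ ps)) (map-∘ ps)) ⟩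
    sum (map bool→ℕ (map inversion ps)) % 2
      ≡⟨ sum-bool→ℕ-%2 (map inversion ps) ⟩
    bool→ℕ (twist C) ∎
    where
    open ≡-Reasoning
    ps : List (Step × Step)
    ps = cyclicPairs (Cycle.steps C)
    count : Pair n × Pair n → ℕ
    count pr = bool→ℕ (isInversion (proj₁ pr) (proj₂ pr))

  Direct⇔twist≡false : (C : Cycle) → Direct {A = A} {B = B} C ⇔ twist C ≡ false
  Direct⇔twist≡false C =
    subst (λ ms → (proj₁ ms ≡ lo (firstS {A = A} {B = B} C)) ⇔ twist C ≡ false)
          (sym (finalMarkers≡orient-twist C)) (proj₁-orient≡lo⇔ _ (twist C))

  Twisted⇔twist≡true : (C : Cycle) → Twisted {A = A} {B = B} C ⇔ twist C ≡ true
  Twisted⇔twist≡true C =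
    subst (λ ms → (proj₁ ms ≡ hi (firstS {A = A} {B = B} C)) ⇔ twist C ≡ true)
          (sym (finalMarkers≡orient-twist C)) (proj₁-orient≡hi⇔ _ (twist C))

-- The hypothesis n ≥ 2 only ensures that G^[2] has vertices; the argument does not use it.
proposition5p5 : (n m : ℕ) → 2 ≤ n
    → (A : Matrix (Fin n) (Fin m)) (B : Matrix (Fin m) (Fin n))
    → (C : G2.Cycle A B)
    → (Direct {A = A} {B = B} C ⇔ 2 ∣ inversions {A = A} {B = B} C)
    × (Twisted {A = A} {B = B} C ⇔ (¬ (2 ∣ inversions {A = A} {B = B} C)))
proposition5p5 n m _ A B C =
  ⇔.trans (Direct⇔twist≡false A B C) (⇔.sym (proj₁ divisibility)) ,
  ⇔.trans (Twisted⇔twist≡true A B C) (⇔.sym (proj₂ divisibility))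
  where
  divisibility : (2 ∣ inversions {A = A} {B = B} C ⇔ twist A B C ≡ false)
               × ((¬ 2 ∣ inversions {A = A} {B = B} C) ⇔ twist A B C ≡ true)
  divisibility = %2≡bool→ℕ⇒divisibility (inversions {A = A} {B = B} C) (twist A B C)
                                        (inversions-%2 A B C)
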